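{- Let $F$ be a formula containing exactly $n$ occurrences of quantifiers ($\exists$ or $\forall$). Then every derivation by the innermost rewrite relation $\to_{\mathcal I}$ starting from $F$ and ending in a formula to which $\to$ is not applicable reaches the (unique) $\to$-normal form $F'$ of $F$ in exactly $n$ steps. Moreover, $n$ is the minimal number of $\to$-steps needed to reach $F'$ from $F$.
   Context: Terms and formulas are those of first-order logic extended by Hilbert's $\varepsilon$-binder. The syntax has: - individual variables; - formula variables; - function and predicate symbols; - the connectives; - for an individual variable $x$ and a formula $F$: the term $\varepsilon x.\,F$ and the formulas $\exists x.\,F$ and $\forall x.\,F$, each binding $x$. Formulas are identified modulo renaming of bound variables. Substitution $F\{x\mapsto t\}$ is capture-avoiding. For $Q\in\{\exists,\forall\}$, write $\neg^{\forall}$ for $\neg$ and $\neg^{\exists}$ for the empty string. The relation $F_1\to F_2$ holds iff $F_2$ is obtained from $F_1$ by replacing one occurrence of a subformula $Q x.\,A$ by $A\{x\mapsto \varepsilon x.\,\neg^{Q}A\}$. The occurrence may lie anywhere in $F_1$, including inside $\varepsilon$-terms and under binders. The innermost rewrite relation $\to_{\mathcal I}$ is the restriction of $\to$ to steps in which the rewritten subformula $Qx.\,A$ is such that $A$ contains no occurrence of a quantifier. A $\to$-normal form of $F$ is a formula $F'$ with $F\to^*F'$ such that no $\to$-step applies to $F'$. -}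

module Defs where

open import Data.Nat using (ℕ; zero; suc; _+_; _≤_)
open import Data.List using (List; []; _∷_)
open import Data.Product using (Σ; ∃; _×_; _,_)
open import Data.Unit using (⊤)
open import Relation.Binary.PropositionalEquality using (_≡_)
open import Relation.Nullary using (¬_)

-- Bound variables are represented by de Bruijn indices, so formulas
-- that differ only by renaming of bound variables are literally equal
-- (formulas are identified modulo α-conversion).

data Quant : Set where
  ∃q ∀q : Quant

mutual
  data Term : Set where
    var : ℕ → Term
    fun : ℕ → List Term → Term
    eps : Formula → Term              -- ε x. A   (binds index 0 in A)

  data Formula : Set where
    fvar  : ℕ → Formula
    pred  : ℕ → List Term → Formula
    ⊤'    : Formula
    ⊥'    : Formula
    ¬'_   : Formula → Formula
    _∧'_  : Formula → Formula → Formula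
    _∨'_  : Formula → Formula → Formula
    _⇒'_  : Formula → Formula → Formula
    quant : Quant → Formula → Formula -- Q x. A  (binds index 0 in A)

wkVar : ℕ → ℕ → ℕ
wkVar zero    i       = suc i
wkVar (suc c) zero    = zero
wkVar (suc c) (suc i) = suc (wkVar c i)

mutual
  wkT : ℕ → Term → Term
  wkT c (var i)    = var (wkVar c i)
  wkT c (fun f ts) = fun f (wkTs c ts)
  wkT c (eps A)    = eps (wkF (suc c) A)

  wkTs : ℕ → List Term → List Term
  wkTs c []       = []
  wkTs c (t ∷ ts) = wkT c t ∷ wkTs c ts

  wkF : ℕ → Formula → Formula
  wkF c (fvar x)    = fvar x
  wkF c (pred p ts) = pred p (wkTs c ts)
  wkF c ⊤'          = ⊤'
  wkF c ⊥'          = ⊥'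
  wkF c (¬' A)      = ¬' wkF c A
  wkF c (A ∧' B)    = wkF c A ∧' wkF c B
  wkF c (A ∨' B)    = wkF c A ∨' wkF c B
  wkF c (A ⇒' B)    = wkF c A ⇒' wkF c B
  wkF c (quant Q A) = quant Q (wkF (suc c) A)

-- Capture-avoiding substitution of t (living in the outer context) for
-- the index bound at depth d; indices above d are decremented.

substVar : ℕ → ℕ → Term → Term
substVar zero    zero    t = t
substVar zero    (suc i) t = var i
substVar (suc d) zero    t = var zero
substVar (suc d) (suc i) t = wkT 0 (substVar d i t)

mutual
  substT : ℕ → Term → Term → Term
  substT d t (var i)    = substVar d i t
  substT d t (fun f ts) = fun f (substTs d t ts)
  substT d t (eps A)    = eps (substF (suc d) t A)

  substTs : ℕ → Term → List Term → List Term
  substTs d t []       = []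
  substTs d t (s ∷ ss) = substT d t s ∷ substTs d t ss

  substF : ℕ → Term → Formula → Formula
  substF d t (fvar x)    = fvar x
  substF d t (pred p ts) = pred p (substTs d t ts)
  substF d t ⊤'          = ⊤'
  substF d t ⊥'          = ⊥'
  substF d t (¬' A)      = ¬' substF d t A
  substF d t (A ∧' B)    = substF d t A ∧' substF d t B
  substF d t (A ∨' B)    = substF d t A ∨' substF d t B
  substF d t (A ⇒' B)    = substF d t A ⇒' substF d t B
  substF d t (quant Q A) = quant Q (substF (suc d) t A)

_[_]₀ : Formula → Term → Formula
A [ t ]₀ = substF 0 t A

mutual
  qcountT : Term → ℕ
  qcountT (var i)    = 0
  qcountT (fun f ts) = qcountTs ts
  qcountT (eps A)    = qcount A

  qcountTs : List Term → ℕ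
  qcountTs []       = 0
  qcountTs (t ∷ ts) = qcountT t + qcountTs ts

  qcount : Formula → ℕ
  qcount (fvar x)    = 0
  qcount (pred p ts) = qcountTs ts
  qcount ⊤'          = 0
  qcount ⊥'          = 0
  qcount (¬' A)      = qcount A
  qcount (A ∧' B)    = qcount A + qcount B
  qcount (A ∨' B)    = qcount A + qcount B
  qcount (A ⇒' B)    = qcount A + qcount B
  qcount (quant Q A) = suc (qcount A)

negQ : Quant → Formula → Formula
negQ ∃q A = A
negQ ∀q A = ¬' A

mutual
  data StepF (P : Quant → Formula → Set) : Formula → Formula → Set where
    redex : ∀ {Q A} → P Q A → StepF P (quant Q A) (A [ eps (negQ Q A) ]₀)
    quant-cong : ∀ {Q A B} → StepF P A B → StepF P (quant Q A) (quant Q B)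
    pred-cong  : ∀ {p ts us} → StepTs P ts us → StepF P (pred p ts) (pred p us)
    ¬-cong     : ∀ {A B} → StepF P A B → StepF P (¬' A) (¬' B)
    ∧-congˡ    : ∀ {A B C} → StepF P A B → StepF P (A ∧' C) (B ∧' C)
    ∧-congʳ    : ∀ {A B C} → StepF P A B → StepF P (C ∧' A) (C ∧' B)
    ∨-congˡ    : ∀ {A B C} → StepF P A B → StepF P (A ∨' C) (B ∨' C)
    ∨-congʳ    : ∀ {A B C} → StepF P A B → StepF P (C ∨' A) (C ∨' B)
    ⇒-congˡ    : ∀ {A B C} → StepF P A B → StepF P (A ⇒' C) (B ⇒' C)
    ⇒-congʳ    : ∀ {A B C} → StepF P A B → StepF P (C ⇒' A) (C ⇒' B)

  data StepT (P : Quant → Formula → Set) : Term → Term → Set where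
    fun-cong : ∀ {f ts us} → StepTs P ts us → StepT P (fun f ts) (fun f us)
    eps-cong : ∀ {A B} → StepF P A B → StepT P (eps A) (eps B)

  data StepTs (P : Quant → Formula → Set) : List Term → List Term → Set where
    here  : ∀ {t u ts} → StepT P t u → StepTs P (t ∷ ts) (u ∷ ts)
    there : ∀ {t ts us} → StepTs P ts us → StepTs P (t ∷ ts) (t ∷ us)

_⟶_ : Formula → Formula → Set
_⟶_ = StepF (λ _ _ → ⊤)

_⟶I_ : Formula → Formula → Set
_⟶I_ = StepF (λ _ A → qcount A ≡ 0)

data Steps (R : Formula → Formula → Set) : ℕ → Formula → Formula → Set where
  done : ∀ {F} → Steps R 0 F F
  step : ∀ {n F G H} → R F G → Steps R n G H → Steps R (suc n) F H

_⟶*_ : Formula → Formula → Set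
F ⟶* G = ∃ λ n → Steps _⟶_ n F G

Irreducible : Formula → Set
Irreducible F = ∀ G → ¬ (F ⟶ G)

IsNormalFormOf : Formula → Formula → Set
IsNormalFormOf F' F = (F ⟶* F') × Irreducible F'

-- The normal form is nf, which eliminates quantifiers innermost-first.  Since nf
-- commutes with substitution, every step F → G satisfies nf F ≡ nf G; a formula is
-- irreducible exactly when it is quantifier-free, and then it is its own nf.  Hence every
-- normal form of F is nf F.  For the step counts: a step in a context contributing c
-- quantifiers turns c + 1 + q(A) quantifiers into c + q(A{x ↦ ε}) ≥ c + q(A), so it removes
-- at most one quantifier, and exactly one when A is quantifier-free.  Thus any →-derivation
-- of F' takes at least n steps and every →_I-derivation to an irreducible formula exactly n.
module Submission where

open import Defs
open import Data.Nat using (ℕ; zero; suc; _+_; _≤_; z≤n; s≤s; _≟_)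
open import Data.Nat.Properties
  using (≤-refl; ≤-trans; +-mono-≤; +-monoʳ-≤; +-suc; +-assoc; +-comm; +-identityʳ;
         m+n≡0⇒m≡0; m+n≡0⇒n≡0; 0≢1+n; suc-injective; module ≤-Reasoning)
open import Data.List using (List; []; _∷_)
open import Data.Product using (Σ; ∃-syntax; _×_; _,_)
open import Data.Sum using (_⊎_; inj₁; inj₂)
open import Data.Unit using (tt)
open import Data.Empty using (⊥-elim)
open import Relation.Nullary using (yes; no)
open import Relation.Binary.PropositionalEquality
  using (_≡_; _≢_; refl; sym; trans; cong; cong₂; subst; subst₂; module ≡-Reasoning)

-- Weakening and substitution

wkVar-wkVar-comm : ∀ c k i → wkVar (suc (c + k)) (wkVar c i) ≡ wkVar c (wkVar (c + k) i)
wkVar-wkVar-comm zero    k i       = refl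
wkVar-wkVar-comm (suc c) k zero    = refl
wkVar-wkVar-comm (suc c) k (suc i) = cong suc (wkVar-wkVar-comm c k i)

mutual
  wkT-wkT-comm : ∀ c k t → wkT (suc (c + k)) (wkT c t) ≡ wkT c (wkT (c + k) t)
  wkT-wkT-comm c k (var i)    = cong var (wkVar-wkVar-comm c k i)
  wkT-wkT-comm c k (fun f ts) = cong (fun f) (wkTs-wkTs-comm c k ts)
  wkT-wkT-comm c k (eps A)    = cong eps (wkF-wkF-comm (suc c) k A)

  wkTs-wkTs-comm : ∀ c k ts → wkTs (suc (c + k)) (wkTs c ts) ≡ wkTs c (wkTs (c + k) ts)
  wkTs-wkTs-comm c k []       = refl
  wkTs-wkTs-comm c k (t ∷ ts) = cong₂ _∷_ (wkT-wkT-comm c k t) (wkTs-wkTs-comm c k ts)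

  wkF-wkF-comm : ∀ c k A → wkF (suc (c + k)) (wkF c A) ≡ wkF c (wkF (c + k) A)
  wkF-wkF-comm c k (fvar x)    = refl
  wkF-wkF-comm c k (pred p ts) = cong (pred p) (wkTs-wkTs-comm c k ts)
  wkF-wkF-comm c k ⊤'          = refl
  wkF-wkF-comm c k ⊥'          = refl
  wkF-wkF-comm c k (¬' A)      = cong ¬'_ (wkF-wkF-comm c k A)
  wkF-wkF-comm c k (A ∧' B)    = cong₂ _∧'_ (wkF-wkF-comm c k A) (wkF-wkF-comm c k B)
  wkF-wkF-comm c k (A ∨' B)    = cong₂ _∨'_ (wkF-wkF-comm c k A) (wkF-wkF-comm c k B)
  wkF-wkF-comm c k (A ⇒' B)    = cong₂ _⇒'_ (wkF-wkF-comm c k A) (wkF-wkF-comm c k B)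
  wkF-wkF-comm c k (quant Q A) = cong (quant Q) (wkF-wkF-comm (suc c) k A)

substVar-wkVar-cancel : ∀ c i v → substVar c (wkVar c i) v ≡ var i
substVar-wkVar-cancel zero    i       v = refl
substVar-wkVar-cancel (suc c) zero    v = refl
substVar-wkVar-cancel (suc c) (suc i) v = cong (wkT 0) (substVar-wkVar-cancel c i v)

mutual
  substT-wkT-cancel : ∀ c v t → substT c v (wkT c t) ≡ t
  substT-wkT-cancel c v (var i)    = substVar-wkVar-cancel c i v
  substT-wkT-cancel c v (fun f ts) = cong (fun f) (substTs-wkTs-cancel c v ts)
  substT-wkT-cancel c v (eps A)    = cong eps (substF-wkF-cancel (suc c) v A)

  substTs-wkTs-cancel : ∀ c v ts → substTs c v (wkTs c ts) ≡ ts
  substTs-wkTs-cancel c v []       = refl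
  substTs-wkTs-cancel c v (t ∷ ts) = cong₂ _∷_ (substT-wkT-cancel c v t) (substTs-wkTs-cancel c v ts)

  substF-wkF-cancel : ∀ c v A → substF c v (wkF c A) ≡ A
  substF-wkF-cancel c v (fvar x)    = refl
  substF-wkF-cancel c v (pred p ts) = cong (pred p) (substTs-wkTs-cancel c v ts)
  substF-wkF-cancel c v ⊤'          = refl
  substF-wkF-cancel c v ⊥'          = refl
  substF-wkF-cancel c v (¬' A)      = cong ¬'_ (substF-wkF-cancel c v A)
  substF-wkF-cancel c v (A ∧' B)    = cong₂ _∧'_ (substF-wkF-cancel c v A) (substF-wkF-cancel c v B)
  substF-wkF-cancel c v (A ∨' B)    = cong₂ _∨'_ (substF-wkF-cancel c v A) (substF-wkF-cancel c v B)
  substF-wkF-cancel c v (A ⇒' B)    = cong₂ _⇒'_ (substF-wkF-cancel c v A) (substF-wkF-cancel c v B)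
  substF-wkF-cancel c v (quant Q A) = cong (quant Q) (substF-wkF-cancel (suc c) v A)

substVar-wkVar-comm : ∀ c k i s →
  substVar (suc (c + k)) (wkVar c i) s ≡ wkT c (substVar (c + k) i s)
substVar-wkVar-comm zero    k i       s = refl
substVar-wkVar-comm (suc c) k zero    s = refl
substVar-wkVar-comm (suc c) k (suc i) s =
  trans (cong (wkT 0) (substVar-wkVar-comm c k i s)) (sym (wkT-wkT-comm 0 c (substVar (c + k) i s)))

mutual
  substT-wkT-comm : ∀ c k s t → substT (suc (c + k)) s (wkT c t) ≡ wkT c (substT (c + k) s t)
  substT-wkT-comm c k s (var i)    = substVar-wkVar-comm c k i s
  substT-wkT-comm c k s (fun f ts) = cong (fun f) (substTs-wkTs-comm c k s ts)
  substT-wkT-comm c k s (eps A)    = cong eps (substF-wkF-comm (suc c) k s A)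

  substTs-wkTs-comm : ∀ c k s ts →
    substTs (suc (c + k)) s (wkTs c ts) ≡ wkTs c (substTs (c + k) s ts)
  substTs-wkTs-comm c k s []       = refl
  substTs-wkTs-comm c k s (t ∷ ts) = cong₂ _∷_ (substT-wkT-comm c k s t) (substTs-wkTs-comm c k s ts)

  substF-wkF-comm : ∀ c k s A → substF (suc (c + k)) s (wkF c A) ≡ wkF c (substF (c + k) s A)
  substF-wkF-comm c k s (fvar x)    = refl
  substF-wkF-comm c k s (pred p ts) = cong (pred p) (substTs-wkTs-comm c k s ts)
  substF-wkF-comm c k s ⊤'          = refl
  substF-wkF-comm c k s ⊥'          = refl
  substF-wkF-comm c k s (¬' A)      = cong ¬'_ (substF-wkF-comm c k s A)
  substF-wkF-comm c k s (A ∧' B)    = cong₂ _∧'_ (substF-wkF-comm c k s A) (substF-wkF-comm c k s B)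
  substF-wkF-comm c k s (A ∨' B)    = cong₂ _∨'_ (substF-wkF-comm c k s A) (substF-wkF-comm c k s B)
  substF-wkF-comm c k s (A ⇒' B)    = cong₂ _⇒'_ (substF-wkF-comm c k s A) (substF-wkF-comm c k s B)
  substF-wkF-comm c k s (quant Q A) = cong (quant Q) (substF-wkF-comm (suc c) k s A)

wkT-substVar-comm : ∀ c k i u →
  wkT (c + k) (substVar c i u) ≡ substVar c (wkVar (suc (c + k)) i) (wkT k u)
wkT-substVar-comm zero    k zero    u = refl
wkT-substVar-comm zero    k (suc i) u = refl
wkT-substVar-comm (suc c) k zero    u = refl
wkT-substVar-comm (suc c) k (suc i) u =
  trans (wkT-wkT-comm 0 (c + k) (substVar c i u)) (cong (wkT 0) (wkT-substVar-comm c k i u))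

mutual
  wkT-substT-comm : ∀ c k u t →
    wkT (c + k) (substT c u t) ≡ substT c (wkT k u) (wkT (suc (c + k)) t)
  wkT-substT-comm c k u (var i)    = wkT-substVar-comm c k i u
  wkT-substT-comm c k u (fun f ts) = cong (fun f) (wkTs-substTs-comm c k u ts)
  wkT-substT-comm c k u (eps A)    = cong eps (wkF-substF-comm (suc c) k u A)

  wkTs-substTs-comm : ∀ c k u ts →
    wkTs (c + k) (substTs c u ts) ≡ substTs c (wkT k u) (wkTs (suc (c + k)) ts)
  wkTs-substTs-comm c k u []       = refl
  wkTs-substTs-comm c k u (t ∷ ts) = cong₂ _∷_ (wkT-substT-comm c k u t) (wkTs-substTs-comm c k u ts)

  wkF-substF-comm : ∀ c k u A →
    wkF (c + k) (substF c u A) ≡ substF c (wkT k u) (wkF (suc (c + k)) A)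
  wkF-substF-comm c k u (fvar x)    = refl
  wkF-substF-comm c k u (pred p ts) = cong (pred p) (wkTs-substTs-comm c k u ts)
  wkF-substF-comm c k u ⊤'          = refl
  wkF-substF-comm c k u ⊥'          = refl
  wkF-substF-comm c k u (¬' A)      = cong ¬'_ (wkF-substF-comm c k u A)
  wkF-substF-comm c k u (A ∧' B)    = cong₂ _∧'_ (wkF-substF-comm c k u A) (wkF-substF-comm c k u B)
  wkF-substF-comm c k u (A ∨' B)    = cong₂ _∨'_ (wkF-substF-comm c k u A) (wkF-substF-comm c k u B)
  wkF-substF-comm c k u (A ⇒' B)    = cong₂ _⇒'_ (wkF-substF-comm c k u A) (wkF-substF-comm c k u B)
  wkF-substF-comm c k u (quant Q A) = cong (quant Q) (wkF-substF-comm (suc c) k u A)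

substT-substVar-comm : ∀ c d i s u →
  substT (c + d) s (substVar c i u) ≡ substT c (substT d s u) (substVar (suc (c + d)) i s)
substT-substVar-comm zero    d zero    s u = refl
substT-substVar-comm zero    d (suc i) s u = sym (substT-wkT-cancel 0 (substT d s u) (substVar d i s))
substT-substVar-comm (suc c) d zero    s u = refl
substT-substVar-comm (suc c) d (suc i) s u = begin
  substT (suc c + d) s (wkT 0 (substVar c i u))            ≡⟨ substT-wkT-comm 0 (c + d) s (substVar c i u) ⟩
  wkT 0 (substT (c + d) s (substVar c i u))                ≡⟨ cong (wkT 0) (substT-substVar-comm c d i s u) ⟩
  wkT 0 (substT c (substT d s u) (substVar (suc (c + d)) i s))
    ≡⟨ sym (substT-wkT-comm 0 c (substT d s u) (substVar (suc (c + d)) i s)) ⟩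
  substT (suc c) (substT d s u) (wkT 0 (substVar (suc (c + d)) i s)) ∎
  where open ≡-Reasoning

mutual
  substT-substT-comm : ∀ c d s u t →
    substT (c + d) s (substT c u t) ≡ substT c (substT d s u) (substT (suc (c + d)) s t)
  substT-substT-comm c d s u (var i)    = substT-substVar-comm c d i s u
  substT-substT-comm c d s u (fun f ts) = cong (fun f) (substTs-substTs-comm c d s u ts)
  substT-substT-comm c d s u (eps A)    = cong eps (substF-substF-comm (suc c) d s u A)

  substTs-substTs-comm : ∀ c d s u ts →
    substTs (c + d) s (substTs c u ts) ≡ substTs c (substT d s u) (substTs (suc (c + d)) s ts)
  substTs-substTs-comm c d s u []       = refl
  substTs-substTs-comm c d s u (t ∷ ts) =
    cong₂ _∷_ (substT-substT-comm c d s u t) (substTs-substTs-comm c d s u ts)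

  substF-substF-comm : ∀ c d s u A →
    substF (c + d) s (substF c u A) ≡ substF c (substT d s u) (substF (suc (c + d)) s A)
  substF-substF-comm c d s u (fvar x)    = refl
  substF-substF-comm c d s u (pred p ts) = cong (pred p) (substTs-substTs-comm c d s u ts)
  substF-substF-comm c d s u ⊤'          = refl
  substF-substF-comm c d s u ⊥'          = refl
  substF-substF-comm c d s u (¬' A)      = cong ¬'_ (substF-substF-comm c d s u A)
  substF-substF-comm c d s u (A ∧' B)    =
    cong₂ _∧'_ (substF-substF-comm c d s u A) (substF-substF-comm c d s u B)
  substF-substF-comm c d s u (A ∨' B)    =
    cong₂ _∨'_ (substF-substF-comm c d s u A) (substF-substF-comm c d s u B)
  substF-substF-comm c d s u (A ⇒' B)    =
    cong₂ _⇒'_ (substF-substF-comm c d s u A) (substF-substF-comm c d s u B)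
  substF-substF-comm c d s u (quant Q A) = cong (quant Q) (substF-substF-comm (suc c) d s u A)

εElim : Quant → Formula → Formula
εElim Q A = A [ eps (negQ Q A) ]₀

negQ-comm : (f : Formula → Formula) → (∀ A → f (¬' A) ≡ ¬' f A) →
  ∀ Q A → f (negQ Q A) ≡ negQ Q (f A)
negQ-comm f f-¬ ∃q A = refl
negQ-comm f f-¬ ∀q A = f-¬ A

wkF-εElim : ∀ c Q A → wkF c (εElim Q A) ≡ εElim Q (wkF (suc c) A)
wkF-εElim c Q A = trans (wkF-substF-comm 0 c (eps (negQ Q A)) A)
  (cong (λ B → substF 0 (eps B) (wkF (suc c) A)) (negQ-comm (wkF (suc c)) (λ _ → refl) Q A))

substF-εElim : ∀ d t Q A → substF d t (εElim Q A) ≡ εElim Q (substF (suc d) t A)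
substF-εElim d t Q A = trans (substF-substF-comm 0 d t (eps (negQ Q A)) A)
  (cong (λ B → substF 0 (eps B) (substF (suc d) t A)) (negQ-comm (substF (suc d) t) (λ _ → refl) Q A))

-- The normal form

mutual
  nfT : Term → Term
  nfT (var i)    = var i
  nfT (fun f ts) = fun f (nfTs ts)
  nfT (eps A)    = eps (nf A)

  nfTs : List Term → List Term
  nfTs []       = []
  nfTs (t ∷ ts) = nfT t ∷ nfTs ts

  nf : Formula → Formula
  nf (fvar x)    = fvar x
  nf (pred p ts) = pred p (nfTs ts)
  nf ⊤'          = ⊤'
  nf ⊥'          = ⊥'
  nf (¬' A)      = ¬' nf A
  nf (A ∧' B)    = nf A ∧' nf B
  nf (A ∨' B)    = nf A ∨' nf B
  nf (A ⇒' B)    = nf A ⇒' nf B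
  nf (quant Q A) = εElim Q (nf A)

mutual
  nfT-wkT : ∀ c t → nfT (wkT c t) ≡ wkT c (nfT t)
  nfT-wkT c (var i)    = refl
  nfT-wkT c (fun f ts) = cong (fun f) (nfTs-wkTs c ts)
  nfT-wkT c (eps A)    = cong eps (nf-wkF (suc c) A)

  nfTs-wkTs : ∀ c ts → nfTs (wkTs c ts) ≡ wkTs c (nfTs ts)
  nfTs-wkTs c []       = refl
  nfTs-wkTs c (t ∷ ts) = cong₂ _∷_ (nfT-wkT c t) (nfTs-wkTs c ts)

  nf-wkF : ∀ c A → nf (wkF c A) ≡ wkF c (nf A)
  nf-wkF c (fvar x)    = refl
  nf-wkF c (pred p ts) = cong (pred p) (nfTs-wkTs c ts)
  nf-wkF c ⊤'          = refl
  nf-wkF c ⊥'          = refl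
  nf-wkF c (¬' A)      = cong ¬'_ (nf-wkF c A)
  nf-wkF c (A ∧' B)    = cong₂ _∧'_ (nf-wkF c A) (nf-wkF c B)
  nf-wkF c (A ∨' B)    = cong₂ _∨'_ (nf-wkF c A) (nf-wkF c B)
  nf-wkF c (A ⇒' B)    = cong₂ _⇒'_ (nf-wkF c A) (nf-wkF c B)
  nf-wkF c (quant Q A) = trans (cong (εElim Q) (nf-wkF (suc c) A)) (sym (wkF-εElim c Q (nf A)))

nfT-substVar : ∀ d i t → nfT (substVar d i t) ≡ substVar d i (nfT t)
nfT-substVar zero    zero    t = refl
nfT-substVar zero    (suc i) t = refl
nfT-substVar (suc d) zero    t = refl
nfT-substVar (suc d) (suc i) t =
  trans (nfT-wkT 0 (substVar d i t)) (cong (wkT 0) (nfT-substVar d i t))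

mutual
  nfT-substT : ∀ d t s → nfT (substT d t s) ≡ substT d (nfT t) (nfT s)
  nfT-substT d t (var i)    = nfT-substVar d i t
  nfT-substT d t (fun f ts) = cong (fun f) (nfTs-substTs d t ts)
  nfT-substT d t (eps A)    = cong eps (nf-substF (suc d) t A)

  nfTs-substTs : ∀ d t ss → nfTs (substTs d t ss) ≡ substTs d (nfT t) (nfTs ss)
  nfTs-substTs d t []       = refl
  nfTs-substTs d t (s ∷ ss) = cong₂ _∷_ (nfT-substT d t s) (nfTs-substTs d t ss)

  nf-substF : ∀ d t A → nf (substF d t A) ≡ substF d (nfT t) (nf A)
  nf-substF d t (fvar x)    = refl
  nf-substF d t (pred p ts) = cong (pred p) (nfTs-substTs d t ts)
  nf-substF d t ⊤'          = refl
  nf-substF d t ⊥'          = refl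
  nf-substF d t (¬' A)      = cong ¬'_ (nf-substF d t A)
  nf-substF d t (A ∧' B)    = cong₂ _∧'_ (nf-substF d t A) (nf-substF d t B)
  nf-substF d t (A ∨' B)    = cong₂ _∨'_ (nf-substF d t A) (nf-substF d t B)
  nf-substF d t (A ⇒' B)    = cong₂ _⇒'_ (nf-substF d t A) (nf-substF d t B)
  nf-substF d t (quant Q A) =
    trans (cong (εElim Q) (nf-substF (suc d) t A)) (sym (substF-εElim d (nfT t) Q (nf A)))

nf-εElim : ∀ Q A → nf (εElim Q A) ≡ nf (quant Q A)
nf-εElim Q A = trans (nf-substF 0 (eps (negQ Q A)) A)
  (cong (λ B → substF 0 (eps B) (nf A)) (negQ-comm nf (λ _ → refl) Q A))

mutual
  nf-stepF : ∀ {P F G} → StepF P F G → nf F ≡ nf G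
  nf-stepF (redex {Q} {A} _) = sym (nf-εElim Q A)
  nf-stepF (quant-cong {Q} s) = cong (εElim Q) (nf-stepF s)
  nf-stepF (pred-cong s)     = cong (pred _) (nf-stepTs s)
  nf-stepF (¬-cong s)        = cong ¬'_ (nf-stepF s)
  nf-stepF (∧-congˡ s)       = cong (_∧' _) (nf-stepF s)
  nf-stepF (∧-congʳ s)       = cong (_ ∧'_) (nf-stepF s)
  nf-stepF (∨-congˡ s)       = cong (_∨' _) (nf-stepF s)
  nf-stepF (∨-congʳ s)       = cong (_ ∨'_) (nf-stepF s)
  nf-stepF (⇒-congˡ s)       = cong (_⇒' _) (nf-stepF s)
  nf-stepF (⇒-congʳ s)       = cong (_ ⇒'_) (nf-stepF s)

  nf-stepT : ∀ {P t u} → StepT P t u → nfT t ≡ nfT u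
  nf-stepT (fun-cong s) = cong (fun _) (nf-stepTs s)
  nf-stepT (eps-cong s) = cong eps (nf-stepF s)

  nf-stepTs : ∀ {P ts us} → StepTs P ts us → nfTs ts ≡ nfTs us
  nf-stepTs (here s)  = cong (_∷ _) (nf-stepT s)
  nf-stepTs (there s) = cong (_ ∷_) (nf-stepTs s)

-- Counting quantifiers

mutual
  qcountT-wkT : ∀ c t → qcountT (wkT c t) ≡ qcountT t
  qcountT-wkT c (var i)    = refl
  qcountT-wkT c (fun f ts) = qcountTs-wkTs c ts
  qcountT-wkT c (eps A)    = qcount-wkF (suc c) A

  qcountTs-wkTs : ∀ c ts → qcountTs (wkTs c ts) ≡ qcountTs ts
  qcountTs-wkTs c []       = refl
  qcountTs-wkTs c (t ∷ ts) = cong₂ _+_ (qcountT-wkT c t) (qcountTs-wkTs c ts)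

  qcount-wkF : ∀ c A → qcount (wkF c A) ≡ qcount A
  qcount-wkF c (fvar x)    = refl
  qcount-wkF c (pred p ts) = qcountTs-wkTs c ts
  qcount-wkF c ⊤'          = refl
  qcount-wkF c ⊥'          = refl
  qcount-wkF c (¬' A)      = qcount-wkF c A
  qcount-wkF c (A ∧' B)    = cong₂ _+_ (qcount-wkF c A) (qcount-wkF c B)
  qcount-wkF c (A ∨' B)    = cong₂ _+_ (qcount-wkF c A) (qcount-wkF c B)
  qcount-wkF c (A ⇒' B)    = cong₂ _+_ (qcount-wkF c A) (qcount-wkF c B)
  qcount-wkF c (quant Q A) = cong suc (qcount-wkF (suc c) A)

qcountT-substVar-qfree : ∀ d i t → qcountT t ≡ 0 → qcountT (substVar d i t) ≡ 0
qcountT-substVar-qfree zero    zero    t t-qfree = t-qfree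
qcountT-substVar-qfree zero    (suc i) t t-qfree = refl
qcountT-substVar-qfree (suc d) zero    t t-qfree = refl
qcountT-substVar-qfree (suc d) (suc i) t t-qfree =
  trans (qcountT-wkT 0 (substVar d i t)) (qcountT-substVar-qfree d i t t-qfree)

mutual
  qcountT-substT-qfree : ∀ d t s → qcountT t ≡ 0 → qcountT (substT d t s) ≡ qcountT s
  qcountT-substT-qfree d t (var i)    t-qfree = qcountT-substVar-qfree d i t t-qfree
  qcountT-substT-qfree d t (fun f ts) t-qfree = qcountTs-substTs-qfree d t ts t-qfree
  qcountT-substT-qfree d t (eps A)    t-qfree = qcount-substF-qfree (suc d) t A t-qfree

  qcountTs-substTs-qfree : ∀ d t ss → qcountT t ≡ 0 → qcountTs (substTs d t ss) ≡ qcountTs ss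
  qcountTs-substTs-qfree d t []       t-qfree = refl
  qcountTs-substTs-qfree d t (s ∷ ss) t-qfree =
    cong₂ _+_ (qcountT-substT-qfree d t s t-qfree) (qcountTs-substTs-qfree d t ss t-qfree)

  qcount-substF-qfree : ∀ d t A → qcountT t ≡ 0 → qcount (substF d t A) ≡ qcount A
  qcount-substF-qfree d t (fvar x)    t-qfree = refl
  qcount-substF-qfree d t (pred p ts) t-qfree = qcountTs-substTs-qfree d t ts t-qfree
  qcount-substF-qfree d t ⊤'          t-qfree = refl
  qcount-substF-qfree d t ⊥'          t-qfree = refl
  qcount-substF-qfree d t (¬' A)      t-qfree = qcount-substF-qfree d t A t-qfree
  qcount-substF-qfree d t (A ∧' B)    t-qfree =
    cong₂ _+_ (qcount-substF-qfree d t A t-qfree) (qcount-substF-qfree d t B t-qfree)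
  qcount-substF-qfree d t (A ∨' B)    t-qfree =
    cong₂ _+_ (qcount-substF-qfree d t A t-qfree) (qcount-substF-qfree d t B t-qfree)
  qcount-substF-qfree d t (A ⇒' B)    t-qfree =
    cong₂ _+_ (qcount-substF-qfree d t A t-qfree) (qcount-substF-qfree d t B t-qfree)
  qcount-substF-qfree d t (quant Q A) t-qfree = cong suc (qcount-substF-qfree (suc d) t A t-qfree)

mutual
  qcountT≤qcountT-substT : ∀ d t s → qcountT s ≤ qcountT (substT d t s)
  qcountT≤qcountT-substT d t (var i)    = z≤n
  qcountT≤qcountT-substT d t (fun f ts) = qcountTs≤qcountTs-substTs d t ts
  qcountT≤qcountT-substT d t (eps A)    = qcount≤qcount-substF (suc d) t A

  qcountTs≤qcountTs-substTs : ∀ d t ss → qcountTs ss ≤ qcountTs (substTs d t ss)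
  qcountTs≤qcountTs-substTs d t []       = z≤n
  qcountTs≤qcountTs-substTs d t (s ∷ ss) =
    +-mono-≤ (qcountT≤qcountT-substT d t s) (qcountTs≤qcountTs-substTs d t ss)

  qcount≤qcount-substF : ∀ d t A → qcount A ≤ qcount (substF d t A)
  qcount≤qcount-substF d t (fvar x)    = z≤n
  qcount≤qcount-substF d t (pred p ts) = qcountTs≤qcountTs-substTs d t ts
  qcount≤qcount-substF d t ⊤'          = z≤n
  qcount≤qcount-substF d t ⊥'          = z≤n
  qcount≤qcount-substF d t (¬' A)      = qcount≤qcount-substF d t A
  qcount≤qcount-substF d t (A ∧' B)    = +-mono-≤ (qcount≤qcount-substF d t A) (qcount≤qcount-substF d t B)
  qcount≤qcount-substF d t (A ∨' B)    = +-mono-≤ (qcount≤qcount-substF d t A) (qcount≤qcount-substF d t B)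
  qcount≤qcount-substF d t (A ⇒' B)    = +-mono-≤ (qcount≤qcount-substF d t A) (qcount≤qcount-substF d t B)
  qcount≤qcount-substF d t (quant Q A) = s≤s (qcount≤qcount-substF (suc d) t A)

qcount-negQ : ∀ Q A → qcount (negQ Q A) ≡ qcount A
qcount-negQ ∃q A = refl
qcount-negQ ∀q A = refl

qcount-εElim-qfree : ∀ Q A → qcount A ≡ 0 → qcount (εElim Q A) ≡ 0
qcount-εElim-qfree Q A A-qfree =
  trans (qcount-substF-qfree 0 (eps (negQ Q A)) A (trans (qcount-negQ Q A) A-qfree)) A-qfree

mutual
  qcountT-nfT : ∀ t → qcountT (nfT t) ≡ 0
  qcountT-nfT (var i)    = refl
  qcountT-nfT (fun f ts) = qcountTs-nfTs ts
  qcountT-nfT (eps A)    = qcount-nf A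

  qcountTs-nfTs : ∀ ts → qcountTs (nfTs ts) ≡ 0
  qcountTs-nfTs []       = refl
  qcountTs-nfTs (t ∷ ts) = cong₂ _+_ (qcountT-nfT t) (qcountTs-nfTs ts)

  qcount-nf : ∀ A → qcount (nf A) ≡ 0
  qcount-nf (fvar x)    = refl
  qcount-nf (pred p ts) = qcountTs-nfTs ts
  qcount-nf ⊤'          = refl
  qcount-nf ⊥'          = refl
  qcount-nf (¬' A)      = qcount-nf A
  qcount-nf (A ∧' B)    = cong₂ _+_ (qcount-nf A) (qcount-nf B)
  qcount-nf (A ∨' B)    = cong₂ _+_ (qcount-nf A) (qcount-nf B)
  qcount-nf (A ⇒' B)    = cong₂ _+_ (qcount-nf A) (qcount-nf B)
  qcount-nf (quant Q A) = qcount-εElim-qfree Q (nf A) (qcount-nf A)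

mutual
  nfT-qfree : ∀ t → qcountT t ≡ 0 → nfT t ≡ t
  nfT-qfree (var i)    _ = refl
  nfT-qfree (fun f ts) z = cong (fun f) (nfTs-qfree ts z)
  nfT-qfree (eps A)    z = cong eps (nf-qfree A z)

  nfTs-qfree : ∀ ts → qcountTs ts ≡ 0 → nfTs ts ≡ ts
  nfTs-qfree []       _ = refl
  nfTs-qfree (t ∷ ts) z = cong₂ _∷_ (nfT-qfree t (m+n≡0⇒m≡0 _ z)) (nfTs-qfree ts (m+n≡0⇒n≡0 _ z))

  nf-qfree : ∀ A → qcount A ≡ 0 → nf A ≡ A
  nf-qfree (fvar x)    _ = refl
  nf-qfree (pred p ts) z = cong (pred p) (nfTs-qfree ts z)
  nf-qfree ⊤'          _ = refl
  nf-qfree ⊥'          _ = refl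
  nf-qfree (¬' A)      z = cong ¬'_ (nf-qfree A z)
  nf-qfree (A ∧' B)    z = cong₂ _∧'_ (nf-qfree A (m+n≡0⇒m≡0 _ z)) (nf-qfree B (m+n≡0⇒n≡0 _ z))
  nf-qfree (A ∨' B)    z = cong₂ _∨'_ (nf-qfree A (m+n≡0⇒m≡0 _ z)) (nf-qfree B (m+n≡0⇒n≡0 _ z))
  nf-qfree (A ⇒' B)    z = cong₂ _⇒'_ (nf-qfree A (m+n≡0⇒m≡0 _ z)) (nf-qfree B (m+n≡0⇒n≡0 _ z))
  nf-qfree (quant Q A) ()

-- How a step from m to n quantifiers arises: the redex Q x. body is rewritten inside a
-- context that carries `context` further quantifiers.
record RedexCount (P : Quant → Formula → Set) (m n : ℕ) : Set where
  constructor redexCount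
  field
    {quantifier} : Quant
    {body}       : Formula
    context      : ℕ
    side         : P quantifier body
    before       : m ≡ context + suc (qcount body)
    after        : n ≡ context + qcount (εElim quantifier body)

module _ {P : Quant → Formula → Set} where

  RedexCount-inˡ : ∀ k {m n} → RedexCount P m n → RedexCount P (k + m) (k + n)
  RedexCount-inˡ k (redexCount c p before after) = redexCount (k + c) p
    (trans (cong (k +_) before) (sym (+-assoc k c _)))
    (trans (cong (k +_) after) (sym (+-assoc k c _)))

  RedexCount-inʳ : ∀ k {m n} → RedexCount P m n → RedexCount P (m + k) (n + k)
  RedexCount-inʳ k {m} {n} r = subst₂ (RedexCount P) (+-comm k m) (+-comm k n) (RedexCount-inˡ k r)

  mutual
    stepF-redexCount : ∀ {F G} → StepF P F G → RedexCount P (qcount F) (qcount G)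
    stepF-redexCount (redex p)           = redexCount 0 p refl refl
    stepF-redexCount (quant-cong s)      = RedexCount-inˡ 1 (stepF-redexCount s)
    stepF-redexCount (pred-cong s)       = stepTs-redexCount s
    stepF-redexCount (¬-cong s)          = stepF-redexCount s
    stepF-redexCount (∧-congˡ {C = C} s) = RedexCount-inʳ (qcount C) (stepF-redexCount s)
    stepF-redexCount (∧-congʳ {C = C} s) = RedexCount-inˡ (qcount C) (stepF-redexCount s)
    stepF-redexCount (∨-congˡ {C = C} s) = RedexCount-inʳ (qcount C) (stepF-redexCount s)
    stepF-redexCount (∨-congʳ {C = C} s) = RedexCount-inˡ (qcount C) (stepF-redexCount s)
    stepF-redexCount (⇒-congˡ {C = C} s) = RedexCount-inʳ (qcount C) (stepF-redexCount s)
    stepF-redexCount (⇒-congʳ {C = C} s) = RedexCount-inˡ (qcount C) (stepF-redexCount s)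

    stepT-redexCount : ∀ {t u} → StepT P t u → RedexCount P (qcountT t) (qcountT u)
    stepT-redexCount (fun-cong s) = stepTs-redexCount s
    stepT-redexCount (eps-cong s) = stepF-redexCount s

    stepTs-redexCount : ∀ {ts us} → StepTs P ts us → RedexCount P (qcountTs ts) (qcountTs us)
    stepTs-redexCount (here {ts = ts} s) = RedexCount-inʳ (qcountTs ts) (stepT-redexCount s)
    stepTs-redexCount (there {t} s)      = RedexCount-inˡ (qcountT t) (stepTs-redexCount s)

  stepF⇒qcount≢0 : ∀ {F G} → StepF P F G → qcount F ≢ 0
  stepF⇒qcount≢0 s F-qfree with stepF-redexCount s
  ... | redexCount c _ before _ = 0≢1+n (trans (sym F-qfree) (trans before (+-suc c _)))

  qcount-stepF-≤ : ∀ {F G} → StepF P F G → qcount F ≤ suc (qcount G)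
  qcount-stepF-≤ {F} {G} s with stepF-redexCount s
  ... | redexCount {Q} {A} c _ before after = begin
    qcount F                      ≡⟨ trans before (+-suc c _) ⟩
    suc (c + qcount A)            ≤⟨ s≤s (+-monoʳ-≤ c (qcount≤qcount-substF 0 (eps (negQ Q A)) A)) ⟩
    suc (c + qcount (εElim Q A))  ≡⟨ cong suc (sym after) ⟩
    suc (qcount G)                ∎
    where open ≤-Reasoning

qcount-innermost-step : ∀ {F G} → F ⟶I G → qcount F ≡ suc (qcount G)
qcount-innermost-step {F} {G} s with stepF-redexCount s
... | redexCount {Q} {A} c A-qfree before after = begin
  qcount F                      ≡⟨ trans before (+-suc c _) ⟩
  suc (c + qcount A)            ≡⟨ cong (λ q → suc (c + q)) A-qfree ⟩
  suc (c + 0)                   ≡⟨ cong (λ q → suc (c + q)) (sym (qcount-εElim-qfree Q A A-qfree)) ⟩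
  suc (c + qcount (εElim Q A))  ≡⟨ cong suc (sym after) ⟩
  suc (qcount G)                ∎
  where open ≡-Reasoning

+≢0 : ∀ m n → m + n ≢ 0 → m ≢ 0 ⊎ n ≢ 0
+≢0 zero    n m+n≢0 = inj₂ m+n≢0
+≢0 (suc m) n _     = inj₁ λ ()

Innermost : Quant → Formula → Set
Innermost _ A = qcount A ≡ 0

mutual
  innermost-stepF : ∀ F → qcount F ≢ 0 → ∃[ G ] F ⟶I G
  innermost-stepF (fvar x)    nz = ⊥-elim (nz refl)
  innermost-stepF (pred p ts) nz with innermost-stepTs ts nz
  ... | us , s = pred p us , pred-cong s
  innermost-stepF ⊤'          nz = ⊥-elim (nz refl)
  innermost-stepF ⊥'          nz = ⊥-elim (nz refl)
  innermost-stepF (¬' A)      nz with innermost-stepF A nz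
  ... | B , s = ¬' B , ¬-cong s
  innermost-stepF (A ∧' B)    nz with +≢0 (qcount A) (qcount B) nz
  ... | inj₁ nzA = let (C , s) = innermost-stepF A nzA in C ∧' B , ∧-congˡ s
  ... | inj₂ nzB = let (C , s) = innermost-stepF B nzB in A ∧' C , ∧-congʳ s
  innermost-stepF (A ∨' B)    nz with +≢0 (qcount A) (qcount B) nz
  ... | inj₁ nzA = let (C , s) = innermost-stepF A nzA in C ∨' B , ∨-congˡ s
  ... | inj₂ nzB = let (C , s) = innermost-stepF B nzB in A ∨' C , ∨-congʳ s
  innermost-stepF (A ⇒' B)    nz with +≢0 (qcount A) (qcount B) nz
  ... | inj₁ nzA = let (C , s) = innermost-stepF A nzA in C ⇒' B , ⇒-congˡ s
  ... | inj₂ nzB = let (C , s) = innermost-stepF B nzB in A ⇒' C , ⇒-congʳ s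
  innermost-stepF (quant Q A) nz with qcount A ≟ 0
  ... | yes A-qfree = εElim Q A , redex A-qfree
  ... | no  nzA     = let (B , s) = innermost-stepF A nzA in quant Q B , quant-cong s

  innermost-stepT : ∀ t → qcountT t ≢ 0 → ∃[ u ] StepT Innermost t u
  innermost-stepT (var i)    nz = ⊥-elim (nz refl)
  innermost-stepT (fun f ts) nz with innermost-stepTs ts nz
  ... | us , s = fun f us , fun-cong s
  innermost-stepT (eps A)    nz with innermost-stepF A nz
  ... | B , s = eps B , eps-cong s

  innermost-stepTs : ∀ ts → qcountTs ts ≢ 0 → ∃[ us ] StepTs Innermost ts us
  innermost-stepTs []       nz = ⊥-elim (nz refl)
  innermost-stepTs (t ∷ ts) nz with +≢0 (qcountT t) (qcountTs ts) nz
  ... | inj₁ nzt  = let (u , s) = innermost-stepT t nzt in u ∷ ts , here s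
  ... | inj₂ nzts = let (us , s) = innermost-stepTs ts nzts in t ∷ us , there s

module _ {P P′ : Quant → Formula → Set} (P⇒P′ : ∀ {Q A} → P Q A → P′ Q A) where

  mutual
    StepF-map : ∀ {F G} → StepF P F G → StepF P′ F G
    StepF-map (redex p)      = redex (P⇒P′ p)
    StepF-map (quant-cong s) = quant-cong (StepF-map s)
    StepF-map (pred-cong s)  = pred-cong (StepTs-map s)
    StepF-map (¬-cong s)     = ¬-cong (StepF-map s)
    StepF-map (∧-congˡ s)    = ∧-congˡ (StepF-map s)
    StepF-map (∧-congʳ s)    = ∧-congʳ (StepF-map s)
    StepF-map (∨-congˡ s)    = ∨-congˡ (StepF-map s)
    StepF-map (∨-congʳ s)    = ∨-congʳ (StepF-map s)
    StepF-map (⇒-congˡ s)    = ⇒-congˡ (StepF-map s)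
    StepF-map (⇒-congʳ s)    = ⇒-congʳ (StepF-map s)

    StepT-map : ∀ {t u} → StepT P t u → StepT P′ t u
    StepT-map (fun-cong s) = fun-cong (StepTs-map s)
    StepT-map (eps-cong s) = eps-cong (StepF-map s)

    StepTs-map : ∀ {ts us} → StepTs P ts us → StepTs P′ ts us
    StepTs-map (here s)  = here (StepT-map s)
    StepTs-map (there s) = there (StepTs-map s)

innermost⇒step : ∀ {F G} → F ⟶I G → F ⟶ G
innermost⇒step = StepF-map (λ _ → tt)

irreducible⇒qfree : ∀ F → Irreducible F → qcount F ≡ 0
irreducible⇒qfree F irr with qcount F ≟ 0
... | yes F-qfree = F-qfree
... | no  nz      = let (G , s) = innermost-stepF F nz in ⊥-elim (irr G (innermost⇒step s))

qfree⇒irreducible : ∀ F → qcount F ≡ 0 → Irreducible F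
qfree⇒irreducible F F-qfree G s = stepF⇒qcount≢0 s F-qfree

module _ {R : Formula → Formula → Set} where

  Steps-map : ∀ {S : Formula → Formula → Set} → (∀ {F G} → R F G → S F G) →
    ∀ {n F G} → Steps R n F G → Steps S n F G
  Steps-map f done        = done
  Steps-map f (step s ss) = step (f s) (Steps-map f ss)

  Steps-invariant : ∀ {a} {X : Set a} (f : Formula → X) → (∀ {F G} → R F G → f F ≡ f G) →
    ∀ {n F G} → Steps R n F G → f F ≡ f G
  Steps-invariant f inv done        = refl
  Steps-invariant f inv (step s ss) = trans (inv s) (Steps-invariant f inv ss)

  Steps-measure-≤ : (μ : Formula → ℕ) → (∀ {F G} → R F G → μ F ≤ suc (μ G)) →
    ∀ {n F G} → Steps R n F G → μ F ≤ n + μ G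
  Steps-measure-≤ μ dec done        = ≤-refl
  Steps-measure-≤ μ dec (step s ss) = ≤-trans (dec s) (s≤s (Steps-measure-≤ μ dec ss))

  Steps-measure-≡ : (μ : Formula → ℕ) → (∀ {F G} → R F G → μ F ≡ suc (μ G)) →
    ∀ {n F G} → Steps R n F G → μ F ≡ n + μ G
  Steps-measure-≡ μ dec done        = refl
  Steps-measure-≡ μ dec (step s ss) = trans (dec s) (cong suc (Steps-measure-≡ μ dec ss))

innermost-steps-to-nf : ∀ n F → qcount F ≡ n → Steps _⟶I_ n F (nf F)
innermost-steps-to-nf zero    F F-qfree = subst (Steps _⟶I_ 0 F) (sym (nf-qfree F F-qfree)) done
innermost-steps-to-nf (suc n) F count
  with innermost-stepF F (λ F-qfree → 0≢1+n (trans (sym F-qfree) count))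
... | G , s = step s (subst (Steps _⟶I_ n G) (sym (nf-stepF s))
  (innermost-steps-to-nf n G (suc-injective (trans (sym (qcount-innermost-step s)) count))))

irreducible-reduct-is-nf : ∀ {P n F G} → Steps (StepF P) n F G → Irreducible G → G ≡ nf F
irreducible-reduct-is-nf {G = G} ss irr =
  trans (sym (nf-qfree G (irreducible⇒qfree G irr))) (sym (Steps-invariant nf nf-stepF ss))

innermost-normalisation-length : ∀ {k F G} → Steps _⟶I_ k F G → Irreducible G → k ≡ qcount F
innermost-normalisation-length {k} {F} {G} ss irr = begin
  k             ≡⟨ sym (+-identityʳ k) ⟩
  k + 0         ≡⟨ cong (k +_) (sym (irreducible⇒qfree G irr)) ⟩
  k + qcount G  ≡⟨ sym (Steps-measure-≡ qcount qcount-innermost-step ss) ⟩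
  qcount F      ∎
  where open ≡-Reasoning

qcount≤normalisation-length : ∀ {P k F G} → Steps (StepF P) k F G → Irreducible G → qcount F ≤ k
qcount≤normalisation-length {k = k} {G = G} ss irr =
  subst (_ ≤_) (trans (cong (k +_) (irreducible⇒qfree G irr)) (+-identityʳ k))
    (Steps-measure-≤ qcount qcount-stepF-≤ ss)

theorem3p9 : (F : Formula) (n : ℕ) → qcount F ≡ n →
    Σ Formula (λ F' →
        (IsNormalFormOf F' F × (∀ G → IsNormalFormOf G F → G ≡ F'))
      × (∀ k G → Steps _⟶I_ k F G → Irreducible G → (k ≡ n × G ≡ F'))
      × Steps _⟶_ n F F'
      × (∀ k → Steps _⟶_ k F F' → n ≤ k))
theorem3p9 F n count =
    nf F
  , ((((n , derivation) , nf-irreducible) , λ G ((_ , ss) , irr) → irreducible-reduct-is-nf ss irr))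
  , (λ k G ss irr → trans (innermost-normalisation-length ss irr) count , irreducible-reduct-is-nf ss irr)
  , derivation
  , (λ k ss → subst (_≤ k) count (qcount≤normalisation-length ss nf-irreducible))
  where
  derivation : Steps _⟶_ n F (nf F)
  derivation = Steps-map innermost⇒step (innermost-steps-to-nf n F count)

  nf-irreducible : Irreducible (nf F)
  nf-irreducible = qfree⇒irreducible (nf F) (qcount-nf F)
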